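{- Let $\psi:\mathbb{N}^2\to\mathbb{C}$ be an arbitrary function (its value at $(a;b)\in\mathbb{N}^2$ written $\psi(a;b)$), and let $n,s$ be positive integers. Then $$\sum_{k=1}^{n^s}\psi(k;n^s)\,(k,n^s)_s=\sum_{d^s\mid n^s}\Phi_s(d^s)\sum_{j=1}^{n^s/d^s}\psi(d^sj;n^s),$$ where the outer sum on the right runs over the positive integers $d$ with $d^s\mid n^s$.
   Context: For a positive integer $s$ and integers $a,b$ not both zero, $(a,b)_s$ denotes the largest $l^s$ with $l\in\mathbb{N}$ dividing both $a$ and $b$. For positive integers $s,m$, Klee's function $\Phi_s(m)$ is the number of integers $k$ with $1\le k\le m$ and $(k,m)_s=1$. -}

module Defs where

open import Level using (Level)
open import Data.Nat using (ℕ; zero; suc; _+_; _*_; _^_; _≟_; NonZero)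
open import Data.Nat.Divisibility using (_∣_; _∣?_)
open import Data.Nat.DivMod using (_/_)
open import Data.Nat.Properties using (m^n≢0)
open import Data.List using (List; []; _∷_; filter; length; upTo; map)
open import Relation.Nullary using (yes; no)
open import Relation.Nullary.Decidable using (_×-dec_)
open import Algebra.Bundles using (CommutativeRing)

range1 : ℕ → List ℕ
range1 m = map suc (upTo m)

searchL : ℕ → ℕ → ℕ → ℕ → ℕ
searchL s a b zero = 1
searchL s a b (suc l) with (suc l ^ s ∣? a) ×-dec (suc l ^ s ∣? b)
... | yes _ = suc l
... | no  _ = searchL s a b l

-- (a , b)_s : the largest l ^ s (l ∈ ℕ) dividing both a and b (a, b not both 0).
-- For s ≥ 1 any such l satisfies l ≤ l ^ s ≤ a + b, so searching up to a + b suffices.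
gcdPow : ℕ → ℕ → ℕ → ℕ
gcdPow s a b = searchL s a b (a + b) ^ s

Φ : ℕ → ℕ → ℕ
Φ s m = length (filter (λ k → gcdPow s k m ≟ 1) (range1 m))

module Sums {c ℓ : Level} (R : CommutativeRing c ℓ) where
  open CommutativeRing R renaming (_+_ to _+R_; _*_ to _*R_)

  _·_ : ℕ → Carrier → Carrier
  zero  · x = 0#
  suc m · x = x +R (m · x)

  sumL : List ℕ → (ℕ → Carrier) → Carrier
  sumL []       f = 0#
  sumL (i ∷ is) f = f i +R sumL is f

  sumTo : ℕ → (ℕ → Carrier) → Carrier
  sumTo m f = sumL (range1 m) f

  lhs : (ℕ → ℕ → Carrier) → ℕ → ℕ → Carrier
  lhs ψ n s = sumTo (n ^ s) (λ k → ψ k (n ^ s) *R (gcdPow s k (n ^ s) · 1#))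

  rhsTerm : (ℕ → ℕ → Carrier) → ℕ → ℕ → ℕ → Carrier
  rhsTerm ψ n s zero     = 0#   -- never used: d ranges over positive integers
  rhsTerm ψ n s (suc d') =
    (Φ s (suc d' ^ s) · 1#) *R
    sumTo ((n ^ s / suc d' ^ s) {{m^n≢0 (suc d') s}})
          (λ j → ψ (suc d' ^ s * j) (n ^ s))

  -- the positive integers d with d ^ s ∣ n ^ s (all such d satisfy d ≤ d^s ≤ n^s)
  divPows : ℕ → ℕ → List ℕ
  divPows n s = filter (λ d → d ^ s ∣? n ^ s) (range1 (n ^ s))

  rhs : (ℕ → ℕ → Carrier) → ℕ → ℕ → Carrier
  rhs ψ n s = sumL (divPows n s) (rhsTerm ψ n s)

-- Write N = n^s and (k, N)_s = t^s. A power d^s divides both k and N exactly when d ∣ t, and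
-- Σ_{d ∣ t} Φ_s(d^s) = t^s: sorting 1 ≤ k ≤ t^s by the root u of (k, t^s)_s, the class with
-- u = t/d consists of the u^s j with (j, d^s)_s = 1, so it has Φ_s(d^s) elements. Hence
-- (k, N)_s = Σ_{d^s ∣ k, d^s ∣ N} Φ_s(d^s); substituting this on the left, exchanging the
-- two sums and writing k = d^s j gives the right-hand side.

module Submission where

open import Level using (Level)
open import Algebra.Bundles using (CommutativeSemiring; CommutativeRing)
open import Data.Nat using (ℕ; _≤_)
open import Defs

module FiniteSums {c ℓ : Level} (S : CommutativeSemiring c ℓ) where

  open import Data.Bool using (Bool; true; false)
  open import Data.Empty using (⊥-elim)
  open import Data.List using (List; []; _∷_; _++_; [_]; filter; map; upTo)
  open import Data.List.Properties using (upTo-∷ʳ; map-++)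
  open import Data.Nat using (suc; zero; _+_; _*_; _<_; _∸_; z≤n; s≤s; _≟_; NonZero; >-nonZero)
  import Data.Nat.Properties as ℕ
  open import Data.Nat.Divisibility using (_∣_; _∣?_; ∣⇒≤; ∣m+n∣m⇒∣n; n∣m*n)
  open import Data.Sum using (inj₁; inj₂)
  open import Relation.Nullary using (Dec; yes; no)
  open import Relation.Nullary.Decidable using (⌊_⌋; _×-dec_)
  open import Relation.Unary using (Pred; Decidable)
  open import Relation.Binary.PropositionalEquality as ≡ using (_≡_; _≢_)
  open CommutativeSemiring S renaming (_+_ to _⊕_; _*_ to _⊛_)
  open import Relation.Binary.Reasoning.Setoid setoid

  ∑ : ℕ → (ℕ → Carrier) → Carrier
  ∑ zero    f = 0#
  ∑ (suc m) f = ∑ m f ⊕ f (suc m)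

  ∑ᴸ : List ℕ → (ℕ → Carrier) → Carrier
  ∑ᴸ []       f = 0#
  ∑ᴸ (i ∷ is) f = f i ⊕ ∑ᴸ is f

  when : Bool → Carrier → Carrier
  when true  x = x
  when false x = 0#

  ∑ᴸ-++ : ∀ xs ys (f : ℕ → Carrier) → ∑ᴸ (xs ++ ys) f ≈ ∑ᴸ xs f ⊕ ∑ᴸ ys f
  ∑ᴸ-++ []       ys f = sym (+-identityˡ _)
  ∑ᴸ-++ (x ∷ xs) ys f = trans (+-congˡ (∑ᴸ-++ xs ys f)) (sym (+-assoc _ _ _))

  range1-suc : ∀ m → range1 (suc m) ≡ range1 m ++ [ suc m ]
  range1-suc m = ≡.trans (≡.cong (map suc) (≡.sym (upTo-∷ʳ m))) (map-++ suc (upTo m) [ m ])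

  ∑ᴸ-range1 : ∀ m (f : ℕ → Carrier) → ∑ᴸ (range1 m) f ≈ ∑ m f
  ∑ᴸ-range1 zero    f = refl
  ∑ᴸ-range1 (suc m) f = begin
    ∑ᴸ (range1 (suc m)) f          ≡⟨ ≡.cong (λ xs → ∑ᴸ xs f) (range1-suc m) ⟩
    ∑ᴸ (range1 m ++ [ suc m ]) f   ≈⟨ ∑ᴸ-++ (range1 m) [ suc m ] f ⟩
    ∑ᴸ (range1 m) f ⊕ (f (suc m) ⊕ 0#) ≈⟨ +-cong (∑ᴸ-range1 m f) (+-identityʳ _) ⟩
    ∑ (suc m) f                    ∎

  ∑ᴸ-filter : ∀ {p} {P : Pred ℕ p} (P? : Decidable P) xs (f : ℕ → Carrier) →
              ∑ᴸ (filter P? xs) f ≈ ∑ᴸ xs (λ x → when ⌊ P? x ⌋ (f x))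
  ∑ᴸ-filter P? []       f = refl
  ∑ᴸ-filter P? (x ∷ xs) f with P? x
  ... | yes _ = +-congˡ (∑ᴸ-filter P? xs f)
  ... | no  _ = trans (∑ᴸ-filter P? xs f) (sym (+-identityˡ _))

  ∑-cong : ∀ m {f g : ℕ → Carrier} → (∀ k → 1 ≤ k → k ≤ m → f k ≈ g k) → ∑ m f ≈ ∑ m g
  ∑-cong zero    f≈g = refl
  ∑-cong (suc m) f≈g =
    +-cong (∑-cong m (λ k 1≤k k≤m → f≈g k 1≤k (ℕ.m≤n⇒m≤1+n k≤m))) (f≈g (suc m) (s≤s z≤n) ℕ.≤-refl)

  ∑-zero : ∀ m {f : ℕ → Carrier} → (∀ k → 1 ≤ k → k ≤ m → f k ≈ 0#) → ∑ m f ≈ 0#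
  ∑-zero m {f} f≈0 = trans (∑-cong m f≈0) (∑-0# m)
    where
    ∑-0# : ∀ m → ∑ m (λ _ → 0#) ≈ 0#
    ∑-0# zero    = refl
    ∑-0# (suc m) = trans (+-identityʳ _) (∑-0# m)

  ∑-+ : ∀ m (f g : ℕ → Carrier) → ∑ m (λ k → f k ⊕ g k) ≈ ∑ m f ⊕ ∑ m g
  ∑-+ zero    f g = sym (+-identityˡ 0#)
  ∑-+ (suc m) f g = begin
    ∑ m (λ k → f k ⊕ g k) ⊕ (f (suc m) ⊕ g (suc m)) ≈⟨ +-congʳ (∑-+ m f g) ⟩
    (∑ m f ⊕ ∑ m g) ⊕ (f (suc m) ⊕ g (suc m))       ≈⟨ medial ⟩
    (∑ m f ⊕ f (suc m)) ⊕ (∑ m g ⊕ g (suc m))       ∎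
    where
    medial : ∀ {a b x y} → (a ⊕ b) ⊕ (x ⊕ y) ≈ (a ⊕ x) ⊕ (b ⊕ y)
    medial {a} {b} {x} {y} = begin
      (a ⊕ b) ⊕ (x ⊕ y) ≈⟨ +-assoc a b (x ⊕ y) ⟩
      a ⊕ (b ⊕ (x ⊕ y)) ≈⟨ +-congˡ (trans (sym (+-assoc b x y)) (+-congʳ (+-comm b x))) ⟩
      a ⊕ ((x ⊕ b) ⊕ y) ≈⟨ +-congˡ (+-assoc x b y) ⟩
      a ⊕ (x ⊕ (b ⊕ y)) ≈⟨ sym (+-assoc a x (b ⊕ y)) ⟩
      (a ⊕ x) ⊕ (b ⊕ y) ∎

  *-distribˡ-∑ : ∀ m a (f : ℕ → Carrier) → a ⊛ ∑ m f ≈ ∑ m (λ k → a ⊛ f k)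
  *-distribˡ-∑ zero    a f = zeroʳ a
  *-distribˡ-∑ (suc m) a f = trans (distribˡ a _ _) (+-congʳ (*-distribˡ-∑ m a f))

  ∑-swap : ∀ m n (h : ℕ → ℕ → Carrier) → ∑ m (λ i → ∑ n (h i)) ≈ ∑ n (λ j → ∑ m (λ i → h i j))
  ∑-swap zero    n h = sym (∑-zero n (λ _ _ _ → refl))
  ∑-swap (suc m) n h = trans (+-congʳ (∑-swap m n h)) (sym (∑-+ n _ _))

  ∑-vanishing-tail : ∀ t N {f : ℕ → Carrier} → t ≤ N → (∀ k → t < k → k ≤ N → f k ≈ 0#) →
                     ∑ N f ≈ ∑ t f
  ∑-vanishing-tail t zero    z≤n _ = refl
  ∑-vanishing-tail t (suc N) t≤1+N f≈0 with ℕ.m≤n⇒m<n∨m≡n t≤1+N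
  ... | inj₂ ≡.refl      = refl
  ... | inj₁ (s≤s t≤N) = trans
    (+-cong (∑-vanishing-tail t N t≤N (λ k t<k k≤N → f≈0 k t<k (ℕ.m≤n⇒m≤1+n k≤N)))
            (f≈0 (suc N) (s≤s t≤N) ℕ.≤-refl))
    (+-identityʳ _)

  ∑-dilate : ∀ D q .{{_ : NonZero D}} (f : ℕ → Carrier) →
             ∑ q (λ j → f (D * j)) ≈ ∑ (q * D) (λ k → when ⌊ D ∣? k ⌋ (f k))
  ∑-dilate D zero f = refl
  ∑-dilate D@(suc D-1) (suc q) f = begin
    ∑ q (λ j → f (D * j)) ⊕ f (D * suc q)   ≈⟨ +-cong (∑-dilate D q f) (reflexive (≡.cong f (ℕ.*-comm D (suc q)))) ⟩
    ∑ (q * D) g ⊕ f (suc q * D)             ≈⟨ +-cong (sym (∑-vanishing-tail (q * D) (D-1 + q * D) (ℕ.m≤n+m _ D-1) gap)) (sym multiple) ⟩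
    ∑ (D-1 + q * D) g ⊕ g (suc q * D)       ∎
    where
    g : ℕ → Carrier
    g k = when ⌊ D ∣? k ⌋ (f k)
    multiple : g (suc q * D) ≈ f (suc q * D)
    multiple with D ∣? suc q * D
    ... | yes _   = refl
    ... | no  D∤ = ⊥-elim (D∤ (n∣m*n (suc q)))
    gap : ∀ k → q * D < k → k ≤ D-1 + q * D → g k ≈ 0#
    gap k qD<k k≤D-1+qD with D ∣? k
    ... | no  _   = refl
    ... | yes D∣k = ⊥-elim (ℕ.<⇒≱ r<D (∣⇒≤ {{>-nonZero (ℕ.m<n⇒0<n∸m qD<k)}} D∣r))
      where
      D∣r : D ∣ k ∸ q * D
      D∣r = ∣m+n∣m⇒∣n (≡.subst (D ∣_) (≡.sym (ℕ.m+[n∸m]≡n (ℕ.<⇒≤ qD<k))) D∣k) (n∣m*n q)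
      r<D : k ∸ q * D < D
      r<D = s≤s (ℕ.≤-trans (ℕ.∸-monoˡ-≤ (q * D) k≤D-1+qD) (ℕ.≤-reflexive (ℕ.m+n∸n≡m D-1 (q * D))))

  ∑-indicator : ∀ m c x → 1 ≤ c → c ≤ m → ∑ m (λ d → when ⌊ d ≟ c ⌋ x) ≈ x
  ∑-indicator m c@(suc c-1) x _ c≤m = begin
    ∑ m g               ≈⟨ ∑-vanishing-tail c m c≤m (λ k c<k _ → off k (ℕ.>⇒≢ c<k)) ⟩
    ∑ c-1 g ⊕ g c       ≈⟨ +-cong (∑-zero c-1 (λ k _ k≤c-1 → off k (ℕ.<⇒≢ (s≤s k≤c-1)))) on ⟩
    0# ⊕ x              ≈⟨ +-identityˡ x ⟩
    x                   ∎
    where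
    g : ℕ → Carrier
    g d = when ⌊ d ≟ c ⌋ x
    off : ∀ k → k ≢ c → g k ≈ 0#
    off k k≢c with k ≟ c
    ... | no  _   = refl
    ... | yes k≡c = ⊥-elim (k≢c k≡c)
    on : g c ≈ x
    on with c ≟ c
    ... | yes _   = refl
    ... | no  c≢c = ⊥-elim (c≢c ≡.refl)

  when-cong-⇔ : ∀ {a b} {A : Set a} {B : Set b} (A? : Dec A) (B? : Dec B) x →
                (A → B) → (B → A) → when ⌊ A? ⌋ x ≈ when ⌊ B? ⌋ x
  when-cong-⇔ (yes _) (yes _) x _ _ = refl
  when-cong-⇔ (no  _) (no  _) x _ _ = refl
  when-cong-⇔ (yes a) (no ¬b) x f _ = ⊥-elim (¬b (f a))
  when-cong-⇔ (no ¬a) (yes b) x _ g = ⊥-elim (¬a (g b))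

  when-when : ∀ {a b} {A : Set a} {B : Set b} (A? : Dec A) (B? : Dec B) x →
              when ⌊ A? ⌋ (when ⌊ B? ⌋ x) ≈ when ⌊ A? ×-dec B? ⌋ x
  when-when (yes _) (yes _) x = refl
  when-when (yes _) (no  _) x = refl
  when-when (no  _) _       x = refl


module PowerGcd where

  open import Data.Empty using (⊥-elim)
  open import Data.Nat
  open import Data.Nat.Properties
  open import Data.Nat.Divisibility
  open import Data.Nat.DivMod using (_/_; m/n*n≡m)
  open import Data.Nat.GCD using (gcd; gcd[m,n]∣m; gcd[m,n]∣n; gcd[m,n]≢0)
  open import Data.Nat.Coprimality using (Coprime; coprime-divisor; coprime-/gcd)
  import Data.Nat.Coprimality as Coprime
  open import Data.Nat.Solver using (module +-*-Solver)
  open import Data.Product using (_×_; _,_; proj₁; proj₂)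
  open import Data.Sum using (inj₁; inj₂)
  open import Relation.Nullary using (yes; no)
  open import Relation.Nullary.Decidable using (_×-dec_)
  open import Relation.Binary.PropositionalEquality
  open +-*-Solver

  ^-distribʳ-* : ∀ m n o → (m * n) ^ o ≡ m ^ o * n ^ o
  ^-distribʳ-* m n zero    = refl
  ^-distribʳ-* m n (suc o) rewrite ^-distribʳ-* m n o =
    solve 4 (λ m n x y → (m :* n) :* (x :* y) := (m :* x) :* (n :* y)) refl m n (m ^ o) (n ^ o)

  ^-monoˡ-∣ : ∀ {m n} o → m ∣ n → m ^ o ∣ n ^ o
  ^-monoˡ-∣ zero    _   = ∣-refl
  ^-monoˡ-∣ (suc o) m∣n = *-pres-∣ m∣n (^-monoˡ-∣ o m∣n)

  m∣m^n : ∀ m {n} → 1 ≤ n → m ∣ m ^ n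
  m∣m^n m {suc n} _ = m∣m*n (m ^ n)

  m≤m^n : ∀ {m n} → 1 ≤ m → 1 ≤ n → m ≤ m ^ n
  m≤m^n {m} {n} 1≤m 1≤n = ∣⇒≤ {{m^n≢0 m n {{>-nonZero 1≤m}}}} (m∣m^n m 1≤n)

  m^n≡1⇒m≡1 : ∀ m {n} → 1 ≤ n → m ^ n ≡ 1 → m ≡ 1
  m^n≡1⇒m≡1 m {n} 1≤n eq with m^n≡1⇒n≡0∨m≡1 m n eq
  ... | inj₂ m≡1 = m≡1
  ... | inj₁ refl = ⊥-elim (<⇒≱ 1≤n z≤n)

  1≤m*n⇒1≤m : ∀ {m n} → 1 ≤ m * n → 1 ≤ m
  1≤m*n⇒1≤m {suc m} _ = s≤s z≤n

  coprime-^ʳ : ∀ {m n} o → Coprime m n → Coprime m (n ^ o)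
  coprime-^ʳ zero    _   (_ , d∣1) = ∣1⇒≡1 d∣1
  coprime-^ʳ {n = n} (suc o) m⊥n {d} (d∣m , d∣n*nᵒ) =
    coprime-^ʳ o m⊥n (d∣m , coprime-divisor d⊥n d∣n*nᵒ)
    where
    d⊥n : Coprime d n
    d⊥n (e∣d , e∣n) = m⊥n (∣-trans e∣d d∣m , e∣n)

  coprime-^ : ∀ {m n} o → Coprime m n → Coprime (m ^ o) (n ^ o)
  coprime-^ o m⊥n = coprime-^ʳ o (Coprime.sym (coprime-^ʳ o (Coprime.sym m⊥n)))

  record CoprimeSplit (e c : ℕ) : Set where
    constructor split
    field
      e′ c′ h : ℕ
      e≡e′*h  : e ≡ e′ * h
      c≡c′*h  : c ≡ c′ * h
      e′⊥c′   : Coprime e′ c′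
      1≤h     : 1 ≤ h

  splitByGcd : ∀ e c → 1 ≤ e → CoprimeSplit e c
  splitByGcd e c 1≤e =
    split (e / g) (c / g) g (sym (m/n*n≡m (gcd[m,n]∣m e c))) (sym (m/n*n≡m (gcd[m,n]∣n e c)))
          (coprime-/gcd e c) 1≤g
    where
    g : ℕ
    g = gcd e c
    1≤g : 1 ≤ g
    1≤g = n≢0⇒n>0 (gcd[m,n]≢0 e c (inj₁ (≢-nonZero⁻¹ e {{>-nonZero 1≤e}})))
    instance
      g≢0 : NonZero g
      g≢0 = >-nonZero 1≤g

  module _ {e c : ℕ} (S : CoprimeSplit e c) where
    open CoprimeSplit S

    split-^∣ : ∀ {y} s → e ^ s ∣ c ^ s * y → e′ ^ s ∣ y
    split-^∣ {y} s e^s∣c^s*y = coprime-divisor (coprime-^ s e′⊥c′) (*-cancelʳ-∣ (h ^ s) e′^s*h^s∣c′^s*y*h^s)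
      where
      instance
        h^s≢0 : NonZero (h ^ s)
        h^s≢0 = m^n≢0 h s {{>-nonZero 1≤h}}
      e′^s*h^s∣c′^s*y*h^s : e′ ^ s * h ^ s ∣ c′ ^ s * y * h ^ s
      e′^s*h^s∣c′^s*y*h^s = subst₂ _∣_
        (trans (cong (_^ s) e≡e′*h) (^-distribʳ-* e′ h s))
        (trans (cong (λ x → x ^ s * y) c≡c′*h)
          (trans (cong (_* y) (^-distribʳ-* c′ h s))
            (solve 3 (λ a b y → (a :* b) :* y := (a :* y) :* b) refl (c′ ^ s) (h ^ s) y)))
        e^s∣c^s*y

    split-∣* : ∀ {t} → e′ ∣ t → e ∣ c * t
    split-∣* {t} e′∣t = ∣-trans e∣h*t (*-monoˡ-∣ t (divides c′ c≡c′*h))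
      where
      e∣h*t : e ∣ h * t
      e∣h*t = subst (_∣ h * t) (trans (*-comm h e′) (sym e≡e′*h)) (*-monoʳ-∣ h e′∣t)

  module _ (s a b : ℕ) where

    searchL-positive : ∀ L → 1 ≤ searchL s a b L
    searchL-positive zero = s≤s z≤n
    searchL-positive (suc l) with (suc l ^ s ∣? a) ×-dec (suc l ^ s ∣? b)
    ... | yes _ = s≤s z≤n
    ... | no  _ = searchL-positive l

    searchL-common : ∀ L → searchL s a b L ^ s ∣ a × searchL s a b L ^ s ∣ b
    searchL-common zero = subst (_∣ a) (sym (^-zeroˡ s)) (1∣ a) , subst (_∣ b) (sym (^-zeroˡ s)) (1∣ b)
    searchL-common (suc l) with (suc l ^ s ∣? a) ×-dec (suc l ^ s ∣? b)
    ... | yes common = common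
    ... | no  _      = searchL-common l

    searchL-maximal : ∀ L {m} → 1 ≤ m → m ≤ L → m ^ s ∣ a → m ^ s ∣ b → m ≤ searchL s a b L
    searchL-maximal zero    1≤m m≤0 _ _ = ⊥-elim (<⇒≱ 1≤m m≤0)
    searchL-maximal (suc l) {m} 1≤m m≤1+l m^s∣a m^s∣b with (suc l ^ s ∣? a) ×-dec (suc l ^ s ∣? b)
    ... | yes _ = m≤1+l
    ... | no ¬common with m ≟ suc l
    ...   | yes refl = ⊥-elim (¬common (m^s∣a , m^s∣b))
    ...   | no  m≢1+l = searchL-maximal l 1≤m (≤-pred (≤∧≢⇒< m≤1+l m≢1+l)) m^s∣a m^s∣b

  powGcdRoot : ℕ → ℕ → ℕ → ℕ
  powGcdRoot s a b = searchL s a b (a + b)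

  record PowGCD (s a b t : ℕ) : Set where
    field
      positive : 1 ≤ t
      commonˡ  : t ^ s ∣ a
      commonʳ  : t ^ s ∣ b
      greatest : ∀ {e} → 1 ≤ e → e ^ s ∣ a → e ^ s ∣ b → e ∣ t

  open PowGCD public

  PowGCD-unique : ∀ {s a b t u} → PowGCD s a b t → PowGCD s a b u → t ≡ u
  PowGCD-unique t-gcd u-gcd =
    ∣-antisym (greatest u-gcd (positive t-gcd) (commonˡ t-gcd) (commonʳ t-gcd))
              (greatest t-gcd (positive u-gcd) (commonˡ u-gcd) (commonʳ u-gcd))

  powGcdRoot-PowGCD : ∀ {s} a b → 1 ≤ s → 1 ≤ b → PowGCD s a b (powGcdRoot s a b)
  powGcdRoot-PowGCD {s} a b 1≤s 1≤b = record
    { positive = 1≤l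
    ; commonˡ  = l^s∣a
    ; commonʳ  = l^s∣b
    ; greatest = greatest′
    }
    where
    l : ℕ
    l = powGcdRoot s a b
    1≤l : 1 ≤ l
    1≤l = searchL-positive s a b (a + b)
    l^s∣a : l ^ s ∣ a
    l^s∣a = proj₁ (searchL-common s a b (a + b))
    l^s∣b : l ^ s ∣ b
    l^s∣b = proj₂ (searchL-common s a b (a + b))

    -- With e = e′ h and l = l′ h, e′ ⊥ l′, the power (e′ l)^s still divides a and b,
    -- so maximality of l forces e′ = 1.
    greatest′ : ∀ {e} → 1 ≤ e → e ^ s ∣ a → e ^ s ∣ b → e ∣ l
    greatest′ {e} 1≤e e^s∣a e^s∣b = subst (e ∣_) (*-identityʳ l) (split-∣* S e′∣1)
      where
      S : CoprimeSplit e l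
      S = splitByGcd e l 1≤e
      open CoprimeSplit S
      1≤e′ : 1 ≤ e′
      1≤e′ = 1≤m*n⇒1≤m (subst (1 ≤_) e≡e′*h 1≤e)
      enlarge : ∀ {x} → e ^ s ∣ x → l ^ s ∣ x → (e′ * l) ^ s ∣ x
      enlarge {x} e^s∣x (divides q refl) = subst (_∣ q * l ^ s) (sym (^-distribʳ-* e′ l s))
        (*-monoˡ-∣ (l ^ s) (split-^∣ S s (subst (e ^ s ∣_) (*-comm q (l ^ s)) e^s∣x)))
      e′l^s∣b : (e′ * l) ^ s ∣ b
      e′l^s∣b = enlarge e^s∣b l^s∣b
      e′l≤a+b : e′ * l ≤ a + b
      e′l≤a+b = ≤-trans (m≤m^n (*-mono-≤ 1≤e′ 1≤l) 1≤s) (≤-trans (∣⇒≤ {{>-nonZero 1≤b}} e′l^s∣b) (m≤n+m b a))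
      e′l≤l : e′ * l ≤ 1 * l
      e′l≤l = subst (e′ * l ≤_) (sym (*-identityˡ l))
        (searchL-maximal s a b (a + b) (*-mono-≤ 1≤e′ 1≤l) e′l≤a+b (enlarge e^s∣a l^s∣a) e′l^s∣b)
      e′∣1 : e′ ∣ 1
      e′∣1 = ∣-reflexive (≤-antisym (*-cancelʳ-≤ e′ 1 l {{>-nonZero 1≤l}} e′l≤l) 1≤e′)

  PowGCD-scale : ∀ {s a b t} c → 1 ≤ c → PowGCD s a b t → PowGCD s (c ^ s * a) (c ^ s * b) (c * t)
  PowGCD-scale {s} {a} {b} {t} c 1≤c t-gcd = record
    { positive = *-mono-≤ 1≤c (positive t-gcd)
    ; commonˡ  = subst (_∣ c ^ s * a) (sym (^-distribʳ-* c t s)) (*-monoʳ-∣ (c ^ s) (commonˡ t-gcd))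
    ; commonʳ  = subst (_∣ c ^ s * b) (sym (^-distribʳ-* c t s)) (*-monoʳ-∣ (c ^ s) (commonʳ t-gcd))
    ; greatest = greatest′
    }
    where
    greatest′ : ∀ {e} → 1 ≤ e → e ^ s ∣ c ^ s * a → e ^ s ∣ c ^ s * b → e ∣ c * t
    greatest′ {e} 1≤e e^s∣c^s*a e^s∣c^s*b =
      split-∣* S (greatest t-gcd 1≤e′ (split-^∣ S s e^s∣c^s*a) (split-^∣ S s e^s∣c^s*b))
      where
      S : CoprimeSplit e c
      S = splitByGcd e c 1≤e
      open CoprimeSplit S
      1≤e′ : 1 ≤ e′
      1≤e′ = 1≤m*n⇒1≤m (subst (1 ≤_) e≡e′*h 1≤e)

  ^∣^⇒∣ : ∀ {s e l} → 1 ≤ s → 1 ≤ e → e ^ s ∣ l ^ s → e ∣ l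
  ^∣^⇒∣ {s} {e} {l} 1≤s 1≤e e^s∣l^s = subst (e ∣_) (*-identityʳ l) (split-∣* S (∣-trans (m∣m^n e′ 1≤s) e′^s∣1))
    where
    S : CoprimeSplit e l
    S = splitByGcd e l 1≤e
    open CoprimeSplit S
    e′^s∣1 : e′ ^ s ∣ 1
    e′^s∣1 = split-^∣ S s (subst (e ^ s ∣_) (sym (*-identityʳ (l ^ s))) e^s∣l^s)


module PowGcdSums where

  open import Data.List using ([]; _∷_; filter; length)
  open import Data.Nat
  open import Data.Nat.Properties
  open import Data.Nat.Divisibility
  open import Data.Product using (_,_; proj₂)
  open import Data.Empty using (⊥-elim)
  open import Relation.Nullary using (Dec; yes; no)
  open import Relation.Nullary.Decidable using (⌊_⌋; _×-dec_)
  open import Relation.Binary.PropositionalEquality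
  open PowerGcd
  open FiniteSums +-*-commutativeSemiring

  length≡∑ᴸ1 : ∀ xs → length xs ≡ ∑ᴸ xs (λ _ → 1)
  length≡∑ᴸ1 []       = refl
  length≡∑ᴸ1 (x ∷ xs) = cong suc (length≡∑ᴸ1 xs)

  ∑1≡m : ∀ m → ∑ m (λ _ → 1) ≡ m
  ∑1≡m zero    = refl
  ∑1≡m (suc m) = trans (cong (_+ 1) (∑1≡m m)) (+-comm m 1)

  Φ≡∑ : ∀ s m → Φ s m ≡ ∑ m (λ k → when ⌊ gcdPow s k m ≟ 1 ⌋ 1)
  Φ≡∑ s m = begin
    length (filter coprime? (range1 m))           ≡⟨ length≡∑ᴸ1 (filter coprime? (range1 m)) ⟩
    ∑ᴸ (filter coprime? (range1 m)) (λ _ → 1)     ≡⟨ ∑ᴸ-filter coprime? (range1 m) (λ _ → 1) ⟩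
    ∑ᴸ (range1 m) (λ k → when ⌊ coprime? k ⌋ 1)  ≡⟨ ∑ᴸ-range1 m _ ⟩
    ∑ m (λ k → when ⌊ coprime? k ⌋ 1)            ∎
    where
    open ≡-Reasoning
    coprime? : ∀ k → Dec (gcdPow s k m ≡ 1)
    coprime? k = gcdPow s k m ≟ 1

  module _ {s : ℕ} (1≤s : 1 ≤ s) {l : ℕ} (1≤l : 1 ≤ l) where

    private
      M : ℕ
      M = l ^ s

      1≤M : 1 ≤ M
      1≤M = m^n>0 l {{>-nonZero 1≤l}} s

      root : ℕ → ℕ
      root k = powGcdRoot s k M

      root-PowGCD : ∀ k → PowGCD s k M (root k)
      root-PowGCD k = powGcdRoot-PowGCD k M 1≤s 1≤M

    Φ≡fibre : ∀ {d} → 1 ≤ d → d ∣ l → Φ s (d ^ s) ≡ ∑ M (λ k → when ⌊ root k * d ≟ l ⌋ 1)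
    Φ≡fibre {d} 1≤d (divides c l≡c*d) = begin
      Φ s (d ^ s)                                                   ≡⟨ Φ≡∑ s (d ^ s) ⟩
      ∑ (d ^ s) (λ j → when ⌊ gcdPow s j (d ^ s) ≟ 1 ⌋ 1)            ≡⟨ ∑-cong (d ^ s) coprime⇔scaled ⟩
      ∑ (d ^ s) (λ j → f (c ^ s * j))                               ≡⟨ ∑-dilate (c ^ s) (d ^ s) {{c^s≢0}} f ⟩
      ∑ (d ^ s * c ^ s) (λ k → when ⌊ c ^ s ∣? k ⌋ (f k))           ≡⟨ cong (λ m → ∑ m (λ k → when ⌊ c ^ s ∣? k ⌋ (f k))) (sym M≡d^s*c^s) ⟩
      ∑ M (λ k → when ⌊ c ^ s ∣? k ⌋ (f k))                         ≡⟨ ∑-cong M (λ k _ _ → guard-redundant k) ⟩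
      ∑ M f                                                         ∎
      where
      open ≡-Reasoning
      f : ℕ → ℕ
      f k = when ⌊ root k * d ≟ l ⌋ 1
      1≤c : 1 ≤ c
      1≤c = 1≤m*n⇒1≤m (subst (1 ≤_) l≡c*d 1≤l)
      c^s≢0 : NonZero (c ^ s)
      c^s≢0 = m^n≢0 c s {{>-nonZero 1≤c}}
      M≡c^s*d^s : M ≡ c ^ s * d ^ s
      M≡c^s*d^s = trans (cong (_^ s) l≡c*d) (^-distribʳ-* c d s)
      M≡d^s*c^s : M ≡ d ^ s * c ^ s
      M≡d^s*c^s = trans M≡c^s*d^s (*-comm (c ^ s) (d ^ s))
      c*u*d≡l⇒u≡1 : ∀ u → c * u * d ≡ l → u ≡ 1
      c*u*d≡l⇒u≡1 u eq = *-cancelˡ-≡ u 1 c {{>-nonZero 1≤c}}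
        (trans (*-cancelʳ-≡ (c * u) c d {{>-nonZero 1≤d}} (trans eq l≡c*d)) (sym (*-identityʳ c)))
      coprime⇔scaled : ∀ j → 1 ≤ j → j ≤ d ^ s → when ⌊ gcdPow s j (d ^ s) ≟ 1 ⌋ 1 ≡ f (c ^ s * j)
      coprime⇔scaled j _ _ = when-cong-⇔ (gcdPow s j (d ^ s) ≟ 1) (root (c ^ s * j) * d ≟ l) 1
        (λ u^s≡1 → trans (cong (_* d) (trans root≡c*u (cong (c *_) (m^n≡1⇒m≡1 u 1≤s u^s≡1))))
                         (trans (cong (_* d) (*-identityʳ c)) (sym l≡c*d)))
        (λ eq → trans (cong (_^ s) (c*u*d≡l⇒u≡1 u (subst (λ r → r * d ≡ l) root≡c*u eq))) (^-zeroˡ s))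
        where
        u : ℕ
        u = powGcdRoot s j (d ^ s)
        scaled : PowGCD s (c ^ s * j) M (c * u)
        scaled = subst (λ m → PowGCD s (c ^ s * j) m (c * u)) (sym M≡c^s*d^s)
          (PowGCD-scale c 1≤c (powGcdRoot-PowGCD j (d ^ s) 1≤s (m^n>0 d {{>-nonZero 1≤d}} s)))
        root≡c*u : root (c ^ s * j) ≡ c * u
        root≡c*u = PowGCD-unique (root-PowGCD (c ^ s * j)) scaled
      guard-redundant : ∀ k → when ⌊ c ^ s ∣? k ⌋ (f k) ≡ f k
      guard-redundant k = trans (when-when (c ^ s ∣? k) (root k * d ≟ l) 1)
        (when-cong-⇔ ((c ^ s ∣? k) ×-dec (root k * d ≟ l)) (root k * d ≟ l) 1 proj₂
          (λ eq → subst (λ r → r ^ s ∣ k) (*-cancelʳ-≡ (root k) c d {{>-nonZero 1≤d}} (trans eq l≡c*d))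
                        (commonˡ (root-PowGCD k)) , eq))

    root∣l : ∀ k → root k ∣ l
    root∣l k = ^∣^⇒∣ 1≤s (positive (root-PowGCD k)) (commonʳ (root-PowGCD k))

    fibres-partition : ∀ k → ∑ l (λ d → when ⌊ root k * d ≟ l ⌋ 1) ≡ 1
    fibres-partition k with root∣l k
    ... | divides v l≡v*r = trans (∑-cong l pointwise) (∑-indicator l v 1 1≤v v≤l)
      where
      l≡r*v : l ≡ root k * v
      l≡r*v = trans l≡v*r (*-comm v (root k))
      1≤v : 1 ≤ v
      1≤v = 1≤m*n⇒1≤m (subst (1 ≤_) l≡v*r 1≤l)
      v≤l : v ≤ l
      v≤l = ∣⇒≤ {{>-nonZero 1≤l}} (divides (root k) l≡r*v)
      pointwise : ∀ d → 1 ≤ d → d ≤ l → when ⌊ root k * d ≟ l ⌋ 1 ≡ when ⌊ d ≟ v ⌋ 1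
      pointwise d _ _ = when-cong-⇔ (root k * d ≟ l) (d ≟ v) 1
        (λ r*d≡l → *-cancelˡ-≡ d v (root k) {{>-nonZero (positive (root-PowGCD k))}} (trans r*d≡l l≡r*v))
        (λ { refl → sym l≡r*v })

    ∑[d∣l]Φ[d^s]≡l^s : ∑ l (λ d → when ⌊ d ∣? l ⌋ (Φ s (d ^ s))) ≡ l ^ s
    ∑[d∣l]Φ[d^s]≡l^s = begin
      ∑ l (λ d → when ⌊ d ∣? l ⌋ (Φ s (d ^ s)))  ≡⟨ ∑-cong l (λ d 1≤d _ → guarded-Φ≡fibre d 1≤d) ⟩
      ∑ l (λ d → ∑ M (λ k → fibre k d))          ≡⟨ ∑-swap l M (λ d k → fibre k d) ⟩
      ∑ M (λ k → ∑ l (fibre k))                  ≡⟨ ∑-cong M (λ k _ _ → fibres-partition k) ⟩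
      ∑ M (λ _ → 1)                              ≡⟨ ∑1≡m M ⟩
      M                                          ∎
      where
      open ≡-Reasoning
      fibre : ℕ → ℕ → ℕ
      fibre k d = when ⌊ root k * d ≟ l ⌋ 1
      guarded-Φ≡fibre : ∀ d → 1 ≤ d → when ⌊ d ∣? l ⌋ (Φ s (d ^ s)) ≡ ∑ M (λ k → fibre k d)
      guarded-Φ≡fibre d 1≤d with d ∣? l
      ... | yes d∣l = Φ≡fibre 1≤d d∣l
      ... | no  d∤l = sym (∑-zero M empty)
        where
        empty : ∀ k → 1 ≤ k → k ≤ M → fibre k d ≡ 0
        empty k _ _ with root k * d ≟ l
        ... | yes r*d≡l = ⊥-elim (d∤l (divides (root k) (sym r*d≡l)))
        ... | no  _     = refl

  ΦWeight : ℕ → ℕ → ℕ → ℕ → ℕ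
  ΦWeight s N d k = when ⌊ d ^ s ∣? N ⌋ (when ⌊ d ^ s ∣? k ⌋ (Φ s (d ^ s)))

  ∑ΦWeight≡gcdPow : ∀ {s} → 1 ≤ s → ∀ k {N} → 1 ≤ N → ∑ N (λ d → ΦWeight s N d k) ≡ gcdPow s k N
  ∑ΦWeight≡gcdPow {s} 1≤s k {N} 1≤N = begin
    ∑ N (λ d → ΦWeight s N d k)                                         ≡⟨ ∑-cong N common⇔∣t ⟩
    ∑ N (λ d → when ⌊ d ∣? t ⌋ (Φ s (d ^ s)))                           ≡⟨ ∑-vanishing-tail t N t≤N beyond ⟩
    ∑ t (λ d → when ⌊ d ∣? t ⌋ (Φ s (d ^ s)))                           ≡⟨ ∑[d∣l]Φ[d^s]≡l^s 1≤s (positive t-gcd) ⟩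
    t ^ s                                                               ∎
    where
    open ≡-Reasoning
    t : ℕ
    t = powGcdRoot s k N
    t-gcd : PowGCD s k N t
    t-gcd = powGcdRoot-PowGCD k N 1≤s 1≤N
    t≤N : t ≤ N
    t≤N = ≤-trans (m≤m^n (positive t-gcd) 1≤s) (∣⇒≤ {{>-nonZero 1≤N}} (commonʳ t-gcd))
    common⇔∣t : ∀ d → 1 ≤ d → d ≤ N → ΦWeight s N d k ≡ when ⌊ d ∣? t ⌋ (Φ s (d ^ s))
    common⇔∣t d 1≤d _ = trans (when-when (d ^ s ∣? N) (d ^ s ∣? k) _)
      (when-cong-⇔ ((d ^ s ∣? N) ×-dec (d ^ s ∣? k)) (d ∣? t) _
        (λ (d^s∣N , d^s∣k) → greatest t-gcd 1≤d d^s∣k d^s∣N)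
        (λ d∣t → ∣-trans (^-monoˡ-∣ s d∣t) (commonʳ t-gcd) , ∣-trans (^-monoˡ-∣ s d∣t) (commonˡ t-gcd)))
    beyond : ∀ d → t < d → d ≤ N → when ⌊ d ∣? t ⌋ (Φ s (d ^ s)) ≡ 0
    beyond d t<d _ with d ∣? t
    ... | no  _   = refl
    ... | yes d∣t = ⊥-elim (<⇒≱ t<d (∣⇒≤ {{>-nonZero (positive t-gcd)}} d∣t))


module RingSums {c ℓ : Level} (R : CommutativeRing c ℓ) where

  open import Data.Nat using (zero; suc; _+_; _*_; _^_; NonZero)
  open import Data.Nat.Properties using (+-*-commutativeSemiring; m^n≢0)
  open import Data.Nat.Divisibility using (_∣?_)
  open import Data.Nat.DivMod using (_/_; m/n*n≡m)
  open import Data.List using ([]; _∷_)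
  open import Relation.Nullary using (yes; no)
  open import Relation.Nullary.Decidable using (⌊_⌋)
  import Relation.Binary.PropositionalEquality as ≡
  open CommutativeRing R renaming (_+_ to _+R_; _*_ to _*R_)
  open Sums R
  open FiniteSums commutativeSemiring
  module ℕ∑ = FiniteSums +-*-commutativeSemiring
  open PowGcdSums using (ΦWeight)
  open import Relation.Binary.Reasoning.Setoid setoid

  sumL≈∑ᴸ : ∀ xs f → sumL xs f ≈ ∑ᴸ xs f
  sumL≈∑ᴸ []       f = refl
  sumL≈∑ᴸ (x ∷ xs) f = +-congˡ (sumL≈∑ᴸ xs f)

  sumTo≈∑ : ∀ m f → sumTo m f ≈ ∑ m f
  sumTo≈∑ m f = trans (sumL≈∑ᴸ (range1 m) f) (∑ᴸ-range1 m f)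

  ·-homo-+ : ∀ a b x → (a + b) · x ≈ (a · x) +R (b · x)
  ·-homo-+ zero    b x = sym (+-identityˡ _)
  ·-homo-+ (suc a) b x = trans (+-congˡ (·-homo-+ a b x)) (sym (+-assoc _ _ _))

  ·-homo-∑ : ∀ m f x → ℕ∑.∑ m f · x ≈ ∑ m (λ k → f k · x)
  ·-homo-∑ zero    f x = refl
  ·-homo-∑ (suc m) f x = trans (·-homo-+ (ℕ∑.∑ m f) (f (suc m)) x) (+-congʳ (·-homo-∑ m f x))

  rhsTerm-expand : ∀ ψ n s d → 1 ≤ d →
    when ⌊ d ^ s ∣? n ^ s ⌋ (rhsTerm ψ n s d) ≈ ∑ (n ^ s) (λ k → ψ k (n ^ s) *R (ΦWeight s (n ^ s) d k · 1#))
  rhsTerm-expand ψ n s d@(suc _) _ with d ^ s ∣? n ^ s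
  ... | no  _   = sym (∑-zero (n ^ s) (λ k _ _ → zeroʳ _))
  ... | yes D∣N = begin
    Φ·1 *R sumTo (N / D) (λ j → ψ (D * j) N)                ≈⟨ *-congˡ (sumTo≈∑ (N / D) _) ⟩
    Φ·1 *R ∑ (N / D) (λ j → ψ (D * j) N)                     ≈⟨ *-congˡ (∑-dilate D (N / D) (λ k → ψ k N)) ⟩
    Φ·1 *R ∑ (N / D * D) (λ k → when ⌊ D ∣? k ⌋ (ψ k N))     ≡⟨ ≡.cong (λ m → Φ·1 *R ∑ m (λ k → when ⌊ D ∣? k ⌋ (ψ k N))) (m/n*n≡m D∣N) ⟩
    Φ·1 *R ∑ N (λ k → when ⌊ D ∣? k ⌋ (ψ k N))               ≈⟨ *-distribˡ-∑ N Φ·1 _ ⟩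
    ∑ N (λ k → Φ·1 *R when ⌊ D ∣? k ⌋ (ψ k N))               ≈⟨ ∑-cong N (λ k _ _ → pointwise k) ⟩
    ∑ N (λ k → ψ k N *R (ℕ∑.when ⌊ D ∣? k ⌋ (Φ s D) · 1#))   ∎
    where
    N D : ℕ
    N = n ^ s
    D = d ^ s
    instance
      D≢0 : NonZero D
      D≢0 = m^n≢0 d s
    Φ·1 : Carrier
    Φ·1 = Φ s D · 1#
    pointwise : ∀ k → Φ·1 *R when ⌊ D ∣? k ⌋ (ψ k N) ≈ ψ k N *R (ℕ∑.when ⌊ D ∣? k ⌋ (Φ s D) · 1#)
    pointwise k with D ∣? k
    ... | yes _ = *-comm _ _
    ... | no  _ = trans (zeroʳ _) (sym (zeroʳ _))


lemma3p2 : {c ℓ : Level} (R : CommutativeRing c ℓ)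
           (ψ : ℕ → ℕ → CommutativeRing.Carrier R) (n s : ℕ) →
           1 ≤ n → 1 ≤ s →
           CommutativeRing._≈_ R (Sums.lhs R ψ n s) (Sums.rhs R ψ n s)
lemma3p2 R ψ n s 1≤n 1≤s = sym (begin
  rhs ψ n s                                                   ≈⟨ sumL≈∑ᴸ (divPows n s) _ ⟩
  ∑ᴸ (divPows n s) (rhsTerm ψ n s)                            ≈⟨ ∑ᴸ-filter (λ d → d ^ s ∣? N) (range1 N) _ ⟩
  ∑ᴸ (range1 N) (λ d → when ⌊ d ^ s ∣? N ⌋ (rhsTerm ψ n s d)) ≈⟨ ∑ᴸ-range1 N _ ⟩
  ∑ N (λ d → when ⌊ d ^ s ∣? N ⌋ (rhsTerm ψ n s d))           ≈⟨ ∑-cong N (λ d 1≤d _ → rhsTerm-expand ψ n s d 1≤d) ⟩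
  ∑ N (λ d → ∑ N (λ k → ψ k N * (weight d k · 1#)))           ≈⟨ ∑-swap N N _ ⟩
  ∑ N (λ k → ∑ N (λ d → ψ k N * (weight d k · 1#)))           ≈⟨ ∑-cong N (λ k _ _ → sym (*-distribˡ-∑ N (ψ k N) _)) ⟩
  ∑ N (λ k → ψ k N * ∑ N (λ d → weight d k · 1#))             ≈⟨ ∑-cong N (λ k _ _ → *-congˡ (sym (·-homo-∑ N (λ d → weight d k) 1#))) ⟩
  ∑ N (λ k → ψ k N * (ℕ∑.∑ N (λ d → weight d k) · 1#))        ≈⟨ ∑-cong N (λ k _ _ → *-congˡ (reflexive (≡.cong (_· 1#) (∑ΦWeight≡gcdPow 1≤s k 1≤N)))) ⟩
  ∑ N (λ k → ψ k N * (gcdPow s k N · 1#))                     ≈⟨ sym (sumTo≈∑ N _) ⟩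
  lhs ψ n s                                                   ∎)
  where
  open import Data.Nat using (_^_; >-nonZero)
  open import Data.Nat.Properties using (m^n>0)
  open import Data.Nat.Divisibility using (_∣?_)
  open import Relation.Nullary.Decidable using (⌊_⌋)
  import Relation.Binary.PropositionalEquality as ≡
  open CommutativeRing R
  open Sums R using (lhs; rhs; rhsTerm; divPows; _·_)
  open FiniteSums commutativeSemiring
  open RingSums R
  open PowGcdSums using (ΦWeight; ∑ΦWeight≡gcdPow)
  open import Relation.Binary.Reasoning.Setoid setoid
  N : ℕ
  N = n ^ s
  1≤N : 1 ≤ N
  1≤N = m^n>0 n {{>-nonZero 1≤n}} s
  weight : ℕ → ℕ → ℕ
  weight = ΦWeight s N
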